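{- Let $G$ be a finite simple graph with Edmonds–Gallai decomposition $V(G)=\mathcal{A}\sqcup\mathcal{C}\sqcup\mathcal{D}$, and let $G_1,\dots,G_k$ be the connected components of $G[\mathcal{D}]$. If $S$ is a critical independent set of $G$, then $S \subseteq \mathcal{C} \cup \bigcup_{i:\,|V(G_i)|=1} V(G_i)$.
   Context: Edmonds–Gallai decomposition: $\mathcal{D}$ is the set of vertices of $G$ that are not covered by at least one maximum matching of $G$; $\mathcal{A}$ is the set of vertices not in $\mathcal{D}$ adjacent to some vertex of $\mathcal{D}$; $\mathcal{C}=V(G)\setminus(\mathcal{A}\cup\mathcal{D})$. $G[U]$ is the induced subgraph on $U$. For $A\subseteq V(G)$, $N(A)$ is the set of vertices adjacent to some vertex of $A$, $d(A)=|A|-|N(A)|$, $d_c(G)=\max\{d(A):A\subseteq V(G)\}$, and $A$ is critical if $d(A)=d_c(G)$. -}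

module Defs where

open import Data.Nat using (ℕ; zero; suc; _≤_)
open import Data.Bool using (Bool; true; false; _∧_; _∨_)
open import Data.Fin using (Fin; zero; suc)
open import Data.Fin.Subset using (Subset; _∈_; _∉_; ∣_∣)
open import Data.Vec using (tabulate)
open import Data.Vec.Functional using () 
open import Data.Integer using (ℤ; +_; _-_) renaming (_≤_ to _≤ℤ_)
open import Data.Product using (_×_; Σ; ∃; ∃-syntax; _,_; proj₁; proj₂)
open import Data.Sum using (_⊎_)
open import Data.List using (List; []; _∷_; length; concatMap)
open import Data.List.Relation.Unary.All using (All)
open import Data.List.Relation.Unary.Unique.Propositional using (Unique)
import Data.List.Membership.Propositional as LM
open import Relation.Binary.PropositionalEquality using (_≡_)
open import Relation.Nullary using (¬_)

record Graph (n : ℕ) : Set where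
  field
    adj     : Fin n → Fin n → Bool
    sym     : ∀ u v → adj u v ≡ adj v u
    irrefl  : ∀ v → adj v v ≡ false
open Graph public

module _ {n : ℕ} (G : Graph n) where

  Adj : Fin n → Fin n → Set
  Adj u v = adj G u v ≡ true

  Edge : Set
  Edge = Fin n × Fin n

  endpoints : List Edge → List (Fin n)
  endpoints = concatMap (λ e → proj₁ e ∷ proj₂ e ∷ [])

  IsMatching : List Edge → Set
  IsMatching M = All (λ e → Adj (proj₁ e) (proj₂ e)) M × Unique (endpoints M)

  IsMaximumMatching : List Edge → Set
  IsMaximumMatching M =
    IsMatching M × (∀ M' → IsMatching M' → length M' ≤ length M)

  Covers : List Edge → Fin n → Set
  Covers M v = v LM.∈ endpoints M

  InD : Fin n → Set
  InD v = ∃[ M ] (IsMaximumMatching M × ¬ Covers M v)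

  InA : Fin n → Set
  InA v = ¬ InD v × (∃[ u ] (InD u × Adj v u))

  InC : Fin n → Set
  InC v = ¬ InA v × ¬ InD v

  data ReachD : Fin n → Fin n → Set where
    here : ∀ {v} → InD v → ReachD v v
    step : ∀ {u v w} → InD u → Adj u v → ReachD v w → ReachD u w

  InSingletonComponentD : Fin n → Set
  InSingletonComponentD v = InD v × (∀ w → ReachD v w → w ≡ v)

  anyFin : ∀ {m} → (Fin m → Bool) → Bool
  anyFin {zero}  f = false
  anyFin {suc m} f = f zero ∨ anyFin (λ i → f (suc i))

  N : Subset n → Subset n
  N A = tabulate (λ v → anyFin (λ u → Data.Vec.lookup A u ∧ adj G u v))
    where import Data.Vec

  d : Subset n → ℤ
  d A = + ∣ A ∣ - + ∣ N A ∣

  IsCritical : Subset n → Set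
  IsCritical A = ∀ B → d B ≤ℤ d A

  IsIndependent : Subset n → Set
  IsIndependent S = ∀ u v → u ∈ S → v ∈ S → adj G u v ≡ false

  IsCriticalIndependent : Subset n → Set
  IsCriticalIndependent S = IsIndependent S × IsCritical S

module Submission where

-- Every maximum matching M₀ covers N(S).  Suppose M₀ misses u ∈ N(S).  Grow
-- T ⊆ N(S) and R ⊆ S with |T| = |R| + 1 such that each t ∈ T is missed by a
-- maximum matching agreeing with M₀ outside T ∪ R; initially T = {u}, R = ∅.
-- Criticality gives |S ∩ N(T)| ≥ |T| > |R|, so some s ∈ S ∖ R has a neighbour
-- t ∈ T.  M₀ matches s (else the matching missing t extends by ts) to some
-- p ∉ T, and re-matching s with t yields a maximum matching missing p, so p
-- joins T and s joins R.  As T cannot grow forever, no vertex of N(S) is in D: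
-- a vertex of S in D is an isolated vertex of G[D], and one outside D has no
-- neighbour in D, so it lies in C.

open import Defs hiding (sym)
open import Data.Bool using (Bool; true; false; _∧_)
import Data.Bool.Properties as Bool
open import Data.Empty using (⊥-elim)
import Data.Empty as Empty
open import Data.Fin using (Fin; zero; suc; _≟_)
open import Data.Fin.Properties using (any?)
open import Data.Fin.Subset
  using (Subset; _∈_; _∉_; _⊆_; _∩_; _∪_; ∁; ⁅_⁆; ⊥; ∣_∣)
open import Data.Fin.Subset.Properties
  using ( _∈?_; ∣p∣≤n; p⊆q⇒∣p∣≤∣q∣; ⊆-antisym; p∩q⊆q; x∈p∩q⁺; x∈p∩q⁻
        ; x∈p∪q⁺; x∈p∪q⁻; x∈⁅x⁆; x∈⁅y⁆⇒x≡y; ∉⊥; ∣⊥∣≡0; ∣⁅x⁆∣≡1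
        ; x∉p⇒x∈∁p; x∈∁p⇒x∉p; ∪-identityˡ; p⊆p∪q; q⊆p∪q)
open import Data.Integer using (ℤ; +_; _-_) renaming (_+_ to _+ℤ_; _≤_ to _≤ℤ_)
import Data.Integer.Properties as ℤ
open import Data.Integer.Tactic.RingSolver using (solve-∀)
open import Data.List
  using (List; []; _∷_; _++_; length; concatMap; foldr; cartesianProductWith; cartesianProduct; allFin)
open import Data.List.Membership.Propositional using (find; lose) renaming (_∈_ to _∈ₗ_)
open import Data.List.Membership.Propositional.Properties
  using (∈-∃++; ∈-concatMap⁺; ∈-concatMap⁻; ∈-cartesianProductWith⁺; ∈-cartesianProduct⁺; ∈-allFin)
import Data.List.Membership.DecPropositional as DecMembership
open import Data.List.Relation.Binary.Permutation.Propositional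
  using (_↭_; ↭-refl; ↭-sym; ↭-trans; ↭⇒↭ₛ)
import Data.List.Relation.Binary.Permutation.Propositional as ↭
open import Data.List.Relation.Binary.Permutation.Propositional.Properties
  using (++⁺ˡ; shift; shifts; ∈-resp-↭; ↭-length)
import Data.List.Relation.Binary.Permutation.Setoid.Properties as Permutationₛ
open import Data.List.Relation.Unary.All as All using (All; []; _∷_)
open import Data.List.Relation.Unary.All.Properties using (¬Any⇒All¬)
open import Data.List.Relation.Unary.Any as Any using (here; there)
open import Data.List.Relation.Unary.Unique.Propositional using (Unique; []; _∷_)
open import Data.List.Relation.Unary.Unique.DecPropositional using (unique?)
open import Data.Nat using (ℕ; zero; suc; _+_; _≤_; _<_; z≤n; s≤s; _<?_)
open import Data.Nat.Properties
  using ( ≤-reflexive; ≤-trans; <⇒≱; ≮⇒≥; +-suc; +-assoc; +-comm; +-monoʳ-≤; +-cancelʳ-≤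
        ; m≤n⇒m≤1+n; module ≤-Reasoning)
open import Data.Product using (_×_; ∃; ∃-syntax; _,_; proj₁; proj₂)
open import Data.Sum using (_⊎_; inj₁; inj₂)
import Data.Sum as Sum
open import Data.Vec using ([]; _∷_; here; there; lookup)
open import Data.Vec.Properties using (lookup∘tabulate; []=⇒lookup; lookup⇒[]=)
open import Function using (_∘_; id)
open import Level using (0ℓ)
open import Relation.Binary.PropositionalEquality
  using (_≡_; _≢_; refl; sym; trans; cong; subst; subst₂; setoid; module ≡-Reasoning)
open import Relation.Nullary using (¬_; Dec; yes; no; _×-dec_; ¬?; contradiction)
open import Relation.Nullary.Decidable using (decidable-stable)
open import Relation.Unary using (Pred; Decidable)

private
  variable
    n : ℕ
    x : Fin n
    p q : Subset n

-- Finite subsets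

∣p∣≡∣p∩q∣+∣p∩∁q∣ : (p q : Subset n) → ∣ p ∣ ≡ ∣ p ∩ q ∣ + ∣ p ∩ ∁ q ∣
∣p∣≡∣p∩q∣+∣p∩∁q∣ []          []          = refl
∣p∣≡∣p∩q∣+∣p∩∁q∣ (false ∷ p) (_ ∷ q)     = ∣p∣≡∣p∩q∣+∣p∩∁q∣ p q
∣p∣≡∣p∩q∣+∣p∩∁q∣ (true ∷ p)  (true ∷ q)  = cong suc (∣p∣≡∣p∩q∣+∣p∩∁q∣ p q)
∣p∣≡∣p∩q∣+∣p∩∁q∣ (true ∷ p)  (false ∷ q) =
  trans (cong suc (∣p∣≡∣p∩q∣+∣p∩∁q∣ p q)) (sym (+-suc _ _))

q⊆p⇒∣p∩q∣≡∣q∣ : q ⊆ p → ∣ p ∩ q ∣ ≡ ∣ q ∣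
q⊆p⇒∣p∩q∣≡∣q∣ q⊆p = cong ∣_∣ (⊆-antisym (p∩q⊆q _ _) (λ x∈q → x∈p∩q⁺ (q⊆p x∈q , x∈q)))

x∉p⇒∣⁅x⁆∪p∣≡1+∣p∣ : x ∉ p → ∣ ⁅ x ⁆ ∪ p ∣ ≡ suc ∣ p ∣
x∉p⇒∣⁅x⁆∪p∣≡1+∣p∣ {x = zero}  {true ∷ p}  x∉p = ⊥-elim (x∉p here)
x∉p⇒∣⁅x⁆∪p∣≡1+∣p∣ {x = zero}  {false ∷ p} x∉p = cong (suc ∘ ∣_∣) (∪-identityˡ p)
x∉p⇒∣⁅x⁆∪p∣≡1+∣p∣ {x = suc x} {true ∷ p}  x∉p = cong suc (x∉p⇒∣⁅x⁆∪p∣≡1+∣p∣ (x∉p ∘ there))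
x∉p⇒∣⁅x⁆∪p∣≡1+∣p∣ {x = suc x} {false ∷ p} x∉p = x∉p⇒∣⁅x⁆∪p∣≡1+∣p∣ (x∉p ∘ there)

∣q∣<∣p∣⇒∃x∈p∖q : ∣ q ∣ < ∣ p ∣ → ∃[ x ] (x ∈ p × x ∉ q)
∣q∣<∣p∣⇒∃x∈p∖q {q = q} {p = p} ∣q∣<∣p∣ with any? (λ x → x ∈? p ×-dec ¬? (x ∈? q))
... | yes x∈p∖q = x∈p∖q
... | no  p∖q≡∅ = contradiction (p⊆q⇒∣p∣≤∣q∣ p⊆q) (<⇒≱ ∣q∣<∣p∣)
  where
  p⊆q : p ⊆ q
  p⊆q {x} x∈p = decidable-stable (x ∈? q) (λ x∉q → p∖q≡∅ (x , x∈p , x∉q))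

x∉p∧y∈p⇒x≢y : ∀ {x y : Fin n} → x ∉ p → y ∈ p → x ≢ y
x∉p∧y∈p⇒x≢y x∉p y∈p refl = x∉p y∈p

⁅x⁆∪p⊆q : x ∈ q → p ⊆ q → ⁅ x ⁆ ∪ p ⊆ q
⁅x⁆∪p⊆q {x = x} {q = q} {p = p} x∈q p⊆q y∈⁅x⁆∪p with x∈p∪q⁻ ⁅ x ⁆ p y∈⁅x⁆∪p
... | inj₁ y∈⁅x⁆ = subst (_∈ q) (sym (x∈⁅y⁆⇒x≡y x y∈⁅x⁆)) x∈q
... | inj₂ y∈p   = p⊆q y∈p

-- Lists: permutations, uniqueness and bounded search

module _ {A B : Set} (f : A → List B) where

  concatMap-↭ : ∀ {xs ys} → xs ↭ ys → concatMap f xs ↭ concatMap f ys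
  concatMap-↭ ↭.refl          = ↭-refl
  concatMap-↭ (↭.prep x σ)    = ++⁺ˡ (f x) (concatMap-↭ σ)
  concatMap-↭ (↭.swap x y σ)  =
    ↭-trans (++⁺ˡ (f x) (++⁺ˡ (f y) (concatMap-↭ σ))) (shifts (f x) (f y))
  concatMap-↭ (↭.trans σ τ)   = ↭-trans (concatMap-↭ σ) (concatMap-↭ τ)

Unique-resp-↭ : ∀ {A : Set} {xs ys : List A} → xs ↭ ys → Unique xs → Unique ys
Unique-resp-↭ {A} σ = Permutationₛ.Unique-resp-↭ (setoid A) (↭⇒↭ₛ σ)

Unique⇒length≤ : {xs : List (Fin n)} → Unique xs → length xs ≤ n
Unique⇒length≤ {n} {xs} unique = subst (_≤ n) (∣elements∣≡length xs unique) (∣p∣≤n (elements xs))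
  where
  elements : List (Fin n) → Subset n
  elements = foldr (λ x → ⁅ x ⁆ ∪_) ⊥

  ∈-elements⁻ : ∀ {x} xs → x ∈ elements xs → x ∈ₗ xs
  ∈-elements⁻ []       x∈ = ⊥-elim (∉⊥ x∈)
  ∈-elements⁻ (y ∷ xs) x∈ with x∈p∪q⁻ ⁅ y ⁆ (elements xs) x∈
  ... | inj₁ x∈⁅y⁆ = here (x∈⁅y⁆⇒x≡y y x∈⁅y⁆)
  ... | inj₂ x∈xs  = there (∈-elements⁻ xs x∈xs)

  ∣elements∣≡length : ∀ xs → Unique xs → ∣ elements xs ∣ ≡ length xs
  ∣elements∣≡length []       []                = ∣⊥∣≡0 n
  ∣elements∣≡length (x ∷ xs) (x∉xs ∷ unique) = trans
    (x∉p⇒∣⁅x⁆∪p∣≡1+∣p∣ (λ x∈ → All.lookup x∉xs (∈-elements⁻ xs x∈) refl))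
    (cong suc (∣elements∣≡length xs unique))

module _ {A : Set} {alphabet : List A} (complete : ∀ x → x ∈ₗ alphabet) where

  lists≤ : ℕ → List (List A)
  lists≤ zero    = [] ∷ []
  lists≤ (suc k) = [] ∷ cartesianProductWith _∷_ alphabet (lists≤ k)

  ∈-lists≤ : ∀ {k} xs → length xs ≤ k → xs ∈ₗ lists≤ k
  ∈-lists≤ {zero}  []       _           = here refl
  ∈-lists≤ {suc k} []       _           = here refl
  ∈-lists≤ {suc k} (x ∷ xs) (s≤s |xs|≤k) =
    there (∈-cartesianProductWith⁺ _∷_ (complete x) (∈-lists≤ xs |xs|≤k))

  bounded-∃? : ∀ k {P : Pred (List A) 0ℓ} → Decidable P →
               (∀ {xs} → P xs → length xs ≤ k) → Dec (∃ P)
  bounded-∃? k P? short with Any.any? P? (lists≤ k)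
  ... | yes found = yes (Any.satisfied found)
  ... | no  none  = no λ (xs , Pxs) → none (lose (∈-lists≤ xs (short Pxs)) Pxs)

-- Neighbourhoods and critical sets

x-y≤z-w⇒x+w≤z+y : ∀ (x y z w : ℤ) → x - y ≤ℤ z - w → x +ℤ w ≤ℤ z +ℤ y
x-y≤z-w⇒x+w≤z+y x y z w x-y≤z-w =
  subst₂ _≤ℤ_ (cancelˡ x y w) (cancelʳ z w y) (ℤ.+-monoˡ-≤ (y +ℤ w) x-y≤z-w)
  where
  cancelˡ : ∀ (x y w : ℤ) → (x - y) +ℤ (y +ℤ w) ≡ x +ℤ w
  cancelˡ = solve-∀
  cancelʳ : ∀ (z w y : ℤ) → (z - w) +ℤ (y +ℤ w) ≡ z +ℤ y
  cancelʳ = solve-∀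

module _ (G : Graph n) where

  anyFin⁻ : ∀ {m} (f : Fin m → Bool) → anyFin G f ≡ true → ∃[ i ] f i ≡ true
  anyFin⁻ {suc m} f any with f zero in f0
  ... | true  = zero , f0
  ... | false with i , fi ← anyFin⁻ (f ∘ suc) any = suc i , fi

  anyFin⁺ : ∀ {m} (f : Fin m → Bool) i → f i ≡ true → anyFin G f ≡ true
  anyFin⁺ f zero    fi rewrite fi = refl
  anyFin⁺ f (suc i) fi with f zero
  ... | true  = refl
  ... | false = anyFin⁺ (f ∘ suc) i fi

  Adj-sym : ∀ {u v} → Adj G u v → Adj G v u
  Adj-sym {u} {v} u~v = trans (Graph.sym G v u) u~v

  ∈N⁻ : ∀ {A v} → v ∈ N G A → ∃[ u ] (u ∈ A × Adj G u v)
  ∈N⁻ {A} {v} v∈NA with anyFin⁻ _ (trans (sym (lookup∘tabulate _ v)) ([]=⇒lookup v∈NA))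
  ... | u , u∈A∧u~v with lookup A u in u∈A
  ... | true = u , lookup⇒[]= u A u∈A , u∈A∧u~v

  ∈N⁺ : ∀ {A u v} → u ∈ A → Adj G u v → v ∈ N G A
  ∈N⁺ {A} {u} {v} u∈A u~v =
    lookup⇒[]= v (N G A) (trans (lookup∘tabulate _ v) (anyFin⁺ _ u u∈A∧u~v))
    where
    u∈A∧u~v : (lookup A u ∧ adj G u v) ≡ true
    u∈A∧u~v rewrite []=⇒lookup u∈A = u~v

  d≤d⇒∣B∣+∣N[A]∣≤∣A∣+∣N[B]∣ : ∀ {A B} → d G B ≤ℤ d G A → ∣ B ∣ + ∣ N G A ∣ ≤ ∣ A ∣ + ∣ N G B ∣
  d≤d⇒∣B∣+∣N[A]∣≤∣A∣+∣N[B]∣ {A} {B} dB≤dA = ℤ.drop‿+≤+ (subst₂ _≤ℤ_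
    (sym (ℤ.pos-+ ∣ B ∣ ∣ N G A ∣)) (sym (ℤ.pos-+ ∣ A ∣ ∣ N G B ∣))
    (x-y≤z-w⇒x+w≤z+y (+ ∣ B ∣) (+ ∣ N G B ∣) (+ ∣ A ∣) (+ ∣ N G A ∣) dB≤dA))

  independent⇒∉N : ∀ {S v} → IsIndependent G S → v ∈ S → v ∉ N G S
  independent⇒∉N independent v∈S v∈NS with ∈N⁻ v∈NS
  ... | u , u∈S , u~v with trans (sym u~v) (independent _ _ u∈S v∈S)
  ... | ()

  -- Criticality of S against S′ = S ∖ N(T), whose neighbourhood avoids T,
  -- says |S′| + |T| ≤ |S ∩ N(T)| + |S′|.
  critical⇒∣T∣≤∣S∩N[T]∣ : ∀ {S T} → IsCritical G S → T ⊆ N G S → ∣ T ∣ ≤ ∣ S ∩ N G T ∣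
  critical⇒∣T∣≤∣S∩N[T]∣ {S} {T} critical T⊆NS = +-cancelʳ-≤ (a + X) t c (begin
    t + (a + X)         ≡⟨ rearrange ⟩
    a + (t + X)         ≡⟨ cong (λ k → a + k) ∣NS∣≡t+X ⟨
    a + ∣ N G S ∣       ≤⟨ d≤d⇒∣B∣+∣N[A]∣≤∣A∣+∣N[B]∣ {S} {S′} (critical S′) ⟩
    ∣ S ∣ + ∣ N G S′ ∣  ≤⟨ +-monoʳ-≤ ∣ S ∣ (p⊆q⇒∣p∣≤∣q∣ NS′⊆NS∖T) ⟩
    ∣ S ∣ + X           ≡⟨ cong (_+ X) (∣p∣≡∣p∩q∣+∣p∩∁q∣ S (N G T)) ⟩
    (c + a) + X         ≡⟨ +-assoc c a X ⟩
    c + (a + X)         ∎)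
    where
    open ≤-Reasoning
    S′ : Subset _
    S′ = S ∩ ∁ (N G T)
    t c a X : ℕ
    t = ∣ T ∣
    c = ∣ S ∩ N G T ∣
    a = ∣ S′ ∣
    X = ∣ N G S ∩ ∁ T ∣
    ∣NS∣≡t+X : ∣ N G S ∣ ≡ t + X
    ∣NS∣≡t+X = trans (∣p∣≡∣p∩q∣+∣p∩∁q∣ (N G S) T) (cong (_+ X) (q⊆p⇒∣p∩q∣≡∣q∣ T⊆NS))
    rearrange : t + (a + X) ≡ a + (t + X)
    rearrange = trans (sym (+-assoc t a X)) (trans (cong (_+ X) (+-comm t a)) (+-assoc a t X))
    NS′⊆NS∖T : N G S′ ⊆ N G S ∩ ∁ T
    NS′⊆NS∖T {v} v∈NS′ with ∈N⁻ v∈NS′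
    ... | u , u∈S′ , u~v = x∈p∩q⁺ (∈N⁺ u∈S u~v , x∉p⇒x∈∁p v∉T)
      where
      u∈S : u ∈ S
      u∈S = proj₁ (x∈p∩q⁻ S _ u∈S′)
      v∉T : v ∉ T
      v∉T v∈T = x∈∁p⇒x∉p (proj₂ (x∈p∩q⁻ S _ u∈S′)) (∈N⁺ v∈T (Adj-sym u~v))

-- Matchings

Matched : List (Fin n × Fin n) → Fin n → Fin n → Set
Matched M y q = (y , q) ∈ₗ M ⊎ (q , y) ∈ₗ M

Matched-sym : ∀ {M} {y q : Fin n} → Matched M y q → Matched M q y
Matched-sym = Sum.swap

Matched-resp-↭ : ∀ {M M′} {y q : Fin n} → M ↭ M′ → Matched M y q → Matched M′ y q
Matched-resp-↭ σ = Sum.map (∈-resp-↭ σ) (∈-resp-↭ σ)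

drop-head : ∀ {e r} {y q : Fin n} → (y , q) ≢ e → (q , y) ≢ e → Matched (e ∷ r) y q → Matched r y q
drop-head yq≢e _    (inj₁ (here yq≡e)) = ⊥-elim (yq≢e yq≡e)
drop-head _    _    (inj₁ (there m))   = inj₁ m
drop-head _    qy≢e (inj₂ (here qy≡e)) = ⊥-elim (qy≢e qy≡e)
drop-head _    _    (inj₂ (there m))   = inj₂ m

module _ (G : Graph n) where

  private
    ends : Edge G → List (Fin n)
    ends (a , b) = a ∷ b ∷ []

  matched⇒covered : ∀ {M y q} → Matched M y q → Covers G M y
  matched⇒covered (inj₁ yq∈M) = ∈-concatMap⁺ ends (lose yq∈M (here refl))
  matched⇒covered (inj₂ qy∈M) = ∈-concatMap⁺ ends (lose qy∈M (there (here refl)))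

  covered⇒matched : ∀ {M y} → Covers G M y → ∃[ q ] Matched M y q
  covered⇒matched y∈ with find (∈-concatMap⁻ ends y∈)
  ... | (a , b) , ab∈M , here refl         = b , inj₁ ab∈M
  ... | (a , b) , ab∈M , there (here refl) = a , inj₂ ab∈M

  matched⇒adj : ∀ {M y q} → IsMatching G M → Matched M y q → Adj G y q
  matched⇒adj (adjacent , _) (inj₁ yq∈M) = All.lookup adjacent yq∈M
  matched⇒adj (adjacent , _) (inj₂ qy∈M) = Adj-sym G (All.lookup adjacent qy∈M)

  augment : ∀ {M a b} → IsMatching G M → Adj G a b →
            ¬ Covers G M a → ¬ Covers G M b → IsMatching G ((a , b) ∷ M)
  augment {M} {a} {b} (adjacent , unique) a~b a∉M b∉M =
    a~b ∷ adjacent , (a≢b ∷ ¬Any⇒All¬ _ a∉M) ∷ ¬Any⇒All¬ _ b∉M ∷ unique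
    where
    a≢b : a ≢ b
    a≢b refl with trans (sym a~b) (irrefl G a)
    ... | ()

  maximum⇒¬augmentable : ∀ {M₀ M a b} → IsMaximumMatching G M₀ →
    IsMatching G M → length M ≡ length M₀ → Adj G a b → ¬ Covers G M a → ¬ Covers G M b → Empty.⊥
  maximum⇒¬augmentable (_ , maximum) M-matching |M|≡|M₀| a~b a∉M b∉M =
    <⇒≱ (s≤s (≤-reflexive (sym |M|≡|M₀|))) (maximum _ (augment M-matching a~b a∉M b∉M))

  record Removal (M : List (Edge G)) (s p : Fin n) : Set where
    field
      rest        : List (Edge G)
      ends-↭      : endpoints G M ↭ s ∷ p ∷ endpoints G rest
      length-rest : length M ≡ suc (length rest)
      rest⊆M      : ∀ {e} → e ∈ₗ rest → e ∈ₗ M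
      keeps       : ∀ {y q} → y ≢ s → y ≢ p → Matched M y q → Matched rest y q

  private
    split-off : ∀ {e} {M : List (Edge G)} → e ∈ₗ M → ∃[ r ] (M ↭ e ∷ r)
    split-off e∈M with xs , ys , refl ← ∈-∃++ e∈M = xs ++ ys , shift _ xs ys

  removal : ∀ {M s p} → Matched M s p → Removal M s p
  removal (inj₁ sp∈M) with r , σ ← split-off sp∈M = record
    { rest        = r
    ; ends-↭      = concatMap-↭ ends σ
    ; length-rest = ↭-length σ
    ; rest⊆M      = ∈-resp-↭ (↭-sym σ) ∘ there
    ; keeps       = λ y≢s y≢p → drop-head (y≢s ∘ cong proj₁) (y≢p ∘ cong proj₂) ∘ Matched-resp-↭ σ
    }
  removal (inj₂ ps∈M) with r , σ ← split-off ps∈M = record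
    { rest        = r
    ; ends-↭      = ↭-trans (concatMap-↭ ends σ) (↭.swap _ _ ↭-refl)
    ; length-rest = ↭-length σ
    ; rest⊆M      = ∈-resp-↭ (↭-sym σ) ∘ there
    ; keeps       = λ y≢s y≢p → drop-head (y≢p ∘ cong proj₁) (y≢s ∘ cong proj₂) ∘ Matched-resp-↭ σ
    }

  module _ {M s p} (R : Removal M s p) where
    open Removal R

    rerouted : Fin n → List (Edge G)
    rerouted t = (s , t) ∷ rest

    private
      ends-rest⊆ : ∀ {y} → y ∈ₗ endpoints G rest → Covers G M y
      ends-rest⊆ y∈rest = ∈-resp-↭ (↭-sym ends-↭) (there (there y∈rest))

      s-covered : Covers G M s
      s-covered = ∈-resp-↭ (↭-sym ends-↭) (here refl)

      p-covered : Covers G M p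
      p-covered = ∈-resp-↭ (↭-sym ends-↭) (there (here refl))

      ends-unique : IsMatching G M → Unique (s ∷ p ∷ endpoints G rest)
      ends-unique (_ , unique) = Unique-resp-↭ ends-↭ unique

    rerouted-isMatching : ∀ {t} → IsMatching G M → ¬ Covers G M t → Adj G s t →
                          IsMatching G (rerouted t)
    rerouted-isMatching {t} M-matching@(adjacent , _) t∉M s~t with ends-unique M-matching
    ... | (_ ∷ s∉rest) ∷ _ ∷ unique =
      s~t ∷ All.tabulate (All.lookup adjacent ∘ rest⊆M) ,
      (s≢t ∷ s∉rest) ∷ ¬Any⇒All¬ _ (t∉M ∘ ends-rest⊆) ∷ unique
      where
      s≢t : s ≢ t
      s≢t refl = t∉M s-covered

    rerouted-length : ∀ {t} → length (rerouted t) ≡ length M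
    rerouted-length = sym length-rest

    rerouted-exposes : ∀ {t} → IsMatching G M → ¬ Covers G M t → ¬ Covers G (rerouted t) p
    rerouted-exposes M-matching t∉M p∈ with ends-unique M-matching | p∈
    ... | (s≢p ∷ _) ∷ _ | here p≡s             = s≢p (sym p≡s)
    ... | _             | there (here refl)    = t∉M p-covered
    ... | _ ∷ p∉rest ∷ _ | there (there p∈rest) = All.lookup p∉rest p∈rest refl

    rerouted-keeps : ∀ {t y q} → y ≢ s → y ≢ p → Matched M y q → Matched (rerouted t) y q
    rerouted-keeps y≢s y≢p = Sum.map there there ∘ keeps y≢s y≢p

    rerouted-covers : ∀ {t y} → y ≢ s → y ≢ t → Covers G (rerouted t) y → Covers G M y
    rerouted-covers y≢s _   (here y≡s)            = ⊥-elim (y≢s y≡s)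
    rerouted-covers _   y≢t (there (here y≡t))    = ⊥-elim (y≢t y≡t)
    rerouted-covers _   _   (there (there y∈rest)) = ends-rest⊆ y∈rest

module _ (G : Graph n) where

  private
    edges : List (Edge G)
    edges = cartesianProduct (allFin n) (allFin n)

    ∈-edges : ∀ e → e ∈ₗ edges
    ∈-edges (a , b) = ∈-cartesianProduct⁺ (∈-allFin a) (∈-allFin b)

    length≤|endpoints| : ∀ M → length M ≤ length (endpoints G M)
    length≤|endpoints| []      = z≤n
    length≤|endpoints| (_ ∷ M) = s≤s (m≤n⇒m≤1+n (length≤|endpoints| M))

  matching-length≤ : ∀ {M} → IsMatching G M → length M ≤ n
  matching-length≤ {M} (_ , unique) = ≤-trans (length≤|endpoints| M) (Unique⇒length≤ unique)

  isMatching? : Decidable (IsMatching G)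
  isMatching? M = All.all? (λ e → adj G (proj₁ e) (proj₂ e) Bool.≟ true) M
            ×-dec unique? _≟_ (endpoints G M)

  isMaximumMatching? : Decidable (IsMaximumMatching G)
  isMaximumMatching? M with isMatching? M
  ... | no ¬matching = no (¬matching ∘ proj₁)
  ... | yes matching
    with bounded-∃? ∈-edges n (λ M′ → isMatching? M′ ×-dec (length M <? length M′))
                              (matching-length≤ ∘ proj₁)
  ...   | yes (M′ , M′-matching , |M|<|M′|) =
    no λ (_ , maximum) → <⇒≱ |M|<|M′| (maximum M′ M′-matching)
  ...   | no  larger∄ =
    yes (matching , λ M′ M′-matching → ≮⇒≥ λ |M|<|M′| → larger∄ (M′ , M′-matching , |M|<|M′|))

  InD? : Decidable (InD G)
  InD? v = bounded-∃? ∈-edges n (λ M → isMaximumMatching? M ×-dec ¬? (v ∈ₗ? endpoints G M))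
                                 (matching-length≤ ∘ proj₁ ∘ proj₁)
    where open DecMembership _≟_ using () renaming (_∈?_ to _∈ₗ?_)

-- Maximum matchings cover the neighbourhood of a critical independent set

module CriticalNeighbourhood
  {G : Graph n} {S : Subset n} (independent : IsIndependent G S) (critical : IsCritical G S)
  {M₀ : List (Edge G)} (M₀-maximum : IsMaximumMatching G M₀) where

  AgreesAt : List (Edge G) → Fin n → Set
  AgreesAt M y = (∀ {q} → Matched M₀ y q → Matched M y q) × (Covers G M y → Covers G M₀ y)

  record Exposing (X : Subset n) (t : Fin n) : Set where
    field
      matching   : List (Edge G)
      isMatching : IsMatching G matching
      size       : length matching ≡ length M₀
      exposes    : ¬ Covers G matching t
      agrees     : ∀ {y} → y ∉ X → AgreesAt matching y

  M₀-exposing : ∀ {X u} → ¬ Covers G M₀ u → Exposing X u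
  M₀-exposing u∉M₀ = record
    { matching = M₀ ; isMatching = proj₁ M₀-maximum ; size = refl ; exposes = u∉M₀
    ; agrees = λ _ → id , id }

  exposing-mono : ∀ {X X′ t} → X ⊆ X′ → Exposing X t → Exposing X′ t
  exposing-mono X⊆X′ E = record
    { matching = matching ; isMatching = isMatching ; size = size ; exposes = exposes
    ; agrees = λ y∉X′ → agrees (y∉X′ ∘ X⊆X′) }
    where open Exposing E

  exposing-reroute : ∀ {X X′ s t p} → Exposing X t → t ∈ X → s ∉ X → Adj G t s → Matched M₀ s p →
                     X ⊆ X′ → s ∈ X′ → p ∈ X′ → Exposing X′ p
  exposing-reroute {X′ = X′} {s} {t} {p} E t∈X s∉X t~s s~p X⊆X′ s∈X′ p∈X′ = record
    { matching   = rerouted G R t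
    ; isMatching = rerouted-isMatching G R isMatching exposes (Adj-sym G t~s)
    ; size       = trans (rerouted-length G R {t}) size
    ; exposes    = rerouted-exposes G R isMatching exposes
    ; agrees     = agrees′
    }
    where
    open Exposing E
    R : Removal G matching s p
    R = removal G (proj₁ (agrees s∉X) s~p)
    agrees′ : ∀ {y} → y ∉ X′ → AgreesAt (rerouted G R t) y
    agrees′ {y} y∉X′ =
      (λ y~q → rerouted-keeps G R {t} y≢s y≢p (keeps y~q)) ,
      (λ y∈ → covered (rerouted-covers G R {t} y≢s y≢t y∈))
      where
      keeps : ∀ {q} → Matched M₀ y q → Matched matching y q
      keeps = proj₁ (agrees (y∉X′ ∘ X⊆X′))
      covered : Covers G matching y → Covers G M₀ y
      covered = proj₂ (agrees (y∉X′ ∘ X⊆X′))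
      y≢s : y ≢ s
      y≢s = x∉p∧y∈p⇒x≢y y∉X′ s∈X′
      y≢p : y ≢ p
      y≢p = x∉p∧y∈p⇒x≢y y∉X′ p∈X′
      y≢t : y ≢ t
      y≢t = x∉p∧y∈p⇒x≢y y∉X′ (X⊆X′ t∈X)

  record Exploration : Set where
    field
      T R       : Subset n
      T⊆N[S]    : T ⊆ N G S
      ∣T∣≡1+∣R∣ : ∣ T ∣ ≡ suc ∣ R ∣
      exposing  : ∀ {t} → t ∈ T → Exposing (T ∪ R) t

  start : ∀ {u} → u ∈ N G S → ¬ Covers G M₀ u → Exploration
  start {u} u∈N[S] u∉M₀ = record
    { T         = ⁅ u ⁆
    ; R         = ⊥
    ; T⊆N[S]    = λ t∈⁅u⁆ → subst (_∈ N G S) (sym (x∈⁅y⁆⇒x≡y u t∈⁅u⁆)) u∈N[S]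
    ; ∣T∣≡1+∣R∣ = trans (∣⁅x⁆∣≡1 u) (cong suc (sym (∣⊥∣≡0 n)))
    ; exposing  = λ t∈⁅u⁆ → subst (Exposing _) (sym (x∈⁅y⁆⇒x≡y u t∈⁅u⁆)) (M₀-exposing u∉M₀)
    }

  module _ (E : Exploration) where
    open Exploration E

    fresh-neighbour : ∃[ s ] (s ∈ S ∩ N G T × s ∉ R)
    fresh-neighbour = ∣q∣<∣p∣⇒∃x∈p∖q
      (subst (_≤ ∣ S ∩ N G T ∣) ∣T∣≡1+∣R∣ (critical⇒∣T∣≤∣S∩N[T]∣ G {S} critical T⊆N[S]))

    ∈S∧∉R⇒∉T∪R : ∀ {v} → v ∈ S → v ∉ R → v ∉ T ∪ R
    ∈S∧∉R⇒∉T∪R v∈S v∉R = Sum.[ v∉T , v∉R ] ∘ x∈p∪q⁻ T R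
      where
      v∉T : _ ∉ T
      v∉T v∈T = independent⇒∉N G independent v∈S (T⊆N[S] v∈T)

    M₀-covers : ∀ {s t} → s ∉ T ∪ R → t ∈ T → Adj G t s → Covers G M₀ s
    M₀-covers {s} s∉X t∈T t~s = decidable-stable (s ∈ₗ? endpoints G M₀) λ s∉M₀ →
      maximum⇒¬augmentable G M₀-maximum isMatching size t~s exposes (s∉M₀ ∘ proj₂ (agrees s∉X))
      where
      open Exposing (exposing t∈T)
      open DecMembership _≟_ using () renaming (_∈?_ to _∈ₗ?_)

    partner∉T : ∀ {s p} → s ∉ T ∪ R → Matched M₀ s p → p ∉ T
    partner∉T s∉X s~p p∈T = exposes (matched⇒covered G (Matched-sym (proj₁ (agrees s∉X) s~p)))
      where open Exposing (exposing p∈T)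

    extend : ∀ {s t p} → s ∈ S → s ∉ T ∪ R → t ∈ T → Adj G t s → Matched M₀ s p → Exploration
    extend {s} {t} {p} s∈S s∉X t∈T t~s s~p = record
      { T         = ⁅ p ⁆ ∪ T
      ; R         = ⁅ s ⁆ ∪ R
      ; T⊆N[S]    = ⁅x⁆∪p⊆q (∈N⁺ G s∈S (matched⇒adj G (proj₁ M₀-maximum) s~p)) T⊆N[S]
      ; ∣T∣≡1+∣R∣ = begin
          ∣ ⁅ p ⁆ ∪ T ∣      ≡⟨ x∉p⇒∣⁅x⁆∪p∣≡1+∣p∣ (partner∉T s∉X s~p) ⟩
          suc ∣ T ∣          ≡⟨ cong suc ∣T∣≡1+∣R∣ ⟩
          suc (suc ∣ R ∣)    ≡⟨ cong suc (x∉p⇒∣⁅x⁆∪p∣≡1+∣p∣ (s∉X ∘ q⊆p∪q T R)) ⟨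
          suc ∣ ⁅ s ⁆ ∪ R ∣  ∎
      ; exposing  = exposing′
      }
      where
      open ≡-Reasoning
      X′ : Subset n
      X′ = (⁅ p ⁆ ∪ T) ∪ (⁅ s ⁆ ∪ R)
      X⊆X′ : T ∪ R ⊆ X′
      X⊆X′ y∈X = x∈p∪q⁺ (Sum.map (q⊆p∪q ⁅ p ⁆ T) (q⊆p∪q ⁅ s ⁆ R) (x∈p∪q⁻ T R y∈X))
      exposing′ : ∀ {x} → x ∈ ⁅ p ⁆ ∪ T → Exposing X′ x
      exposing′ x∈T′ with x∈p∪q⁻ ⁅ p ⁆ T x∈T′
      ... | inj₁ x∈⁅p⁆ = subst (Exposing X′) (sym (x∈⁅y⁆⇒x≡y p x∈⁅p⁆))
              (exposing-reroute (exposing t∈T) (p⊆p∪q R t∈T) s∉X t~s s~p X⊆X′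
                 (q⊆p∪q _ _ (p⊆p∪q R (x∈⁅x⁆ s))) (p⊆p∪q _ (p⊆p∪q T (x∈⁅x⁆ p))))
      ... | inj₂ x∈T   = exposing-mono X⊆X′ (exposing x∈T)

  grow : (E : Exploration) → ∃[ E′ ] suc ∣ Exploration.T E ∣ ≡ ∣ Exploration.T E′ ∣
  grow E
    with s , s∈S∩N[T] , s∉R ← fresh-neighbour E
    with s∈S , s∈N[T]      ← x∈p∩q⁻ S _ s∈S∩N[T]
    with s∉T∪R             ← ∈S∧∉R⇒∉T∪R E s∈S s∉R
    with t , t∈T , t~s      ← ∈N⁻ G s∈N[T]
    with p , s~p            ← covered⇒matched G (M₀-covers E s∉T∪R t∈T t~s)
    = extend E s∈S s∉T∪R t∈T t~s s~p , sym (x∉p⇒∣⁅x⁆∪p∣≡1+∣p∣ (partner∉T E s∉T∪R s~p))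

  explore : Exploration → ∀ k → ∃[ E′ ] k ≤ ∣ Exploration.T E′ ∣
  explore E zero    = E , z≤n
  explore E (suc k) =
    let E′ , k≤∣T′∣ = explore E k
        E″ , ∣T″∣≡1+∣T′∣ = grow E′
    in E″ , subst (suc k ≤_) ∣T″∣≡1+∣T′∣ (s≤s k≤∣T′∣)

  ¬exploration : ¬ Exploration
  ¬exploration E =
    let E′ , n<∣T′∣ = explore E (suc n) in <⇒≱ n<∣T′∣ (∣p∣≤n (Exploration.T E′))

N[S]∩D≡∅ : ∀ (G : Graph n) S → IsCriticalIndependent G S → ∀ {u} → u ∈ N G S → ¬ InD G u
N[S]∩D≡∅ G S (independent , critical) u∈N[S] (M₀ , M₀-maximum , u∉M₀) =
  ¬exploration (start u∈N[S] u∉M₀)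
  where open CriticalNeighbourhood {G = G} {S} independent critical M₀-maximum

ReachD⇒InD : ∀ {G : Graph n} {x w} → ReachD G x w → InD G x
ReachD⇒InD (here x∈D)     = x∈D
ReachD⇒InD (step x∈D _ _) = x∈D

theorem5p5 : ∀ {n : ℕ} (G : Graph n) (S : Subset n) →
    IsCriticalIndependent G S →
    ∀ v → v ∈ S → InC G v ⊎ InSingletonComponentD G v
theorem5p5 G S critical-independent v v∈S with InD? G v
... | yes v∈D = inj₂ (v∈D , singleton)
  where
  singleton : ∀ w → ReachD G v w → w ≡ v
  singleton w (here _)         = refl
  singleton w (step _ v~u u⇝w) = ⊥-elim (N[S]∩D≡∅ G S critical-independent (∈N⁺ G v∈S v~u) (ReachD⇒InD u⇝w))
... | no  v∉D = inj₁ (not-A , v∉D)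
  where
  not-A : ¬ InA G v
  not-A (_ , u , u∈D , v~u) = N[S]∩D≡∅ G S critical-independent (∈N⁺ G v∈S v~u) u∈D
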